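{- Let $P_{4,4}$ be the square tetromino (a $2\times2$ block of unit squares). Then $\tau(P_{4,4})=(0,3,5,\infty)$, i.e. $P_{4,4}$ is a $(1,0)$-winner, a $(1,1)$-loser, a $(2,3)$-winner, a $(2,4)$-loser, a $(3,5)$-winner, a $(3,6)$-loser, and an $(n,b)$-winner for all $n\ge4$ and all $b\ge0$.
   Context: The board is the tiling of the plane by unit squares (cells); cells are adjacent if they share an edge. A polyomino is a finite connected set of cells up to congruence. In the weak $(a,b)$ achievement game ($a\ge1,b\ge0$) for a goal polyomino $A$ on the infinite board, maker and breaker alternately mark previously unmarked cells, maker first, $a$ resp. $b$ cells per turn; the maker wins if his marked cells at some point contain a set congruent to $A$; $A$ is an $(a,b)$-winner if the maker has a strategy guaranteeing a win in finitely many turns against every breaker play, otherwise an $(a,b)$-loser. The threshold sequence $\tau(A)=(b_1,b_2,\ldots)$ has $b_n$ the greatest $b$ for which $A$ is an $(n,b)$-winner ($\infty$ if for all $b$); $(b_1,\ldots,b_{k-1},\infty)$ denotes the sequence with $b_n=\infty$ for all $n\ge k$. -}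

module Defs where

open import Data.Nat using (ℕ)
open import Data.Integer using (ℤ; +_; -_) renaming (_+_ to _+ℤ_)
open import Data.Product using (_×_; _,_; ∃)
open import Data.Sum using (_⊎_)
open import Data.List using (List; []; _∷_; _++_; length)
open import Data.List.Membership.Propositional using (_∈_; _∉_)
open import Data.List.Relation.Unary.All using (All)
open import Data.List.Relation.Unary.Unique.Propositional using (Unique)
open import Relation.Binary.PropositionalEquality using (_≡_)
open import Relation.Nullary using (¬_)

Cell : Set
Cell = ℤ × ℤ

-- The 8 linear isometries of ℤ² fixing the origin (dihedral group D4).
data Sym : Set where
  r0 r90 r180 r270 fx fy fd fa : Sym

act : Sym → Cell → Cell
act r0   (x , y) = (x , y)
act r90  (x , y) = (- y , x)
act r180 (x , y) = (- x , - y)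
act r270 (x , y) = (y , - x)
act fx   (x , y) = (x , - y)
act fy   (x , y) = (- x , y)
act fd   (x , y) = (y , x)
act fa   (x , y) = (- y , - x)

isom : Sym → Cell → Cell → Cell
isom g (tx , ty) c with act g c
... | (x , y) = (x +ℤ tx , y +ℤ ty)

-- A goal polyomino is given by a representative list of its cells.
-- `Contains A M`: the set M contains a set congruent to A.
Contains : List Cell → List Cell → Set
Contains A M = ∃ λ (g : Sym) → ∃ λ (t : Cell) → All (λ c → isom g t c ∈ M) A

Fresh : List Cell → List Cell → List Cell → Set
Fresh k M B = Unique k × All (λ c → (c ∉ M) × (c ∉ B)) k

-- Maker (to move, having marked M; breaker having marked B) has a strategy that
-- wins in finitely many turns against every breaker play in the weak (a,b) game.
-- Inductive = every play consistent with the strategy ends in a maker win.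
data MakerWins (A : List Cell) (a b : ℕ) : List Cell → List Cell → Set where
  move : ∀ {M B} (m : List Cell) → length m ≡ a → Fresh m M B →
         (Contains A (m ++ M) ⊎
          ((k : List Cell) → length k ≡ b → Fresh k (m ++ M) B →
             MakerWins A a b (m ++ M) (k ++ B))) →
         MakerWins A a b M B

Winner : List Cell → ℕ → ℕ → Set
Winner A a b = MakerWins A a b [] []

Loser : List Cell → ℕ → ℕ → Set
Loser A a b = ¬ Winner A a b

P44 : List Cell
P44 = (+ 0 , + 0) ∷ (+ 1 , + 0) ∷ (+ 0 , + 1) ∷ (+ 1 , + 1) ∷ []

module Submission where

-- Against (1,1) breaker plays a
-- pairing strategy for a domino tiling in which every 2×2 square contains a domino
-- (`pairingLoser`).  Against (a,b) with a ≤ 3 and 2a ≤ b he keeps every square through a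
-- maker cell blocked, answering each maker cell by its two neighbours along a suitably
-- chosen axis (`coverLoser`).
--
-- With n ≥ 4 cells per turn maker places a square at once; against b = 0 he
-- places one cell per turn.  For (3,5) and (2,3) he first plants far-apart seeds
-- (`seeding`); a pigeonhole count over their disjoint 3×3 neighbourhoods (`Pigeonhole`)
-- yields seeds with at most one breaker cell nearby.  For (3,5) such a seed is completed
-- in one move (`completeSeed`); for (2,3) maker extends two such seeds to dominoes, making
-- four disjoint two-cell threats that three breaker cells cannot all hit (`twoThreats`).

open import Defs
open import Data.Nat using (ℕ; _≥_)
open import Data.Product using (_×_)

open import Data.Nat using (zero; suc; _+_; _*_; _∸_; _≤_; _<_; z≤n; s≤s; _≤?_)
import Data.Nat.Properties as ℕₚ
open import Data.Integer using (ℤ; +_; -[1+_]; ∣_∣) renaming (suc to sucℤ; pred to predℤ)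
import Data.Integer.Properties as ℤₚ
open import Data.Product using (∃; ∃₂; _,_; proj₁; proj₂)
open import Data.Product.Properties using (≡-dec)
open import Data.Sum as Sum using (_⊎_; inj₁; inj₂; [_,_]′)
open import Data.Empty using (⊥-elim)
open import Data.List using (List; []; _∷_; _++_; length; map; filter)
open import Data.List.Relation.Unary.Any as Any using (Any; here; there)
open import Data.List.Relation.Unary.All as All using (All; []; _∷_)
open import Data.List.Membership.Propositional using (_∈_; _∉_)
open import Data.List.Membership.Propositional.Properties
  using (∈-map⁺; ∈-map⁻; ∈-++⁺ˡ; ∈-++⁺ʳ; ∈-++⁻; ∈-filter⁺; ∈-filter⁻)
open import Data.List.Properties
  using (length-++; length-map; length-filter; ++-assoc; map-++; filter-accept; filter-reject)
open import Data.List.Relation.Unary.AllPairs as AllPairs using (AllPairs; []; _∷_)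
import Data.List.Relation.Unary.AllPairs.Properties as AllPairsₚ
open import Data.List.Relation.Unary.Unique.Propositional using (Unique)
import Data.List.Relation.Unary.Unique.Propositional.Properties as Uniqueₚ
import Data.List.Relation.Unary.All.Properties as Allₚ
open import Data.List.Relation.Binary.Disjoint.Propositional {A = Cell} using (Disjoint)
open import Data.List.Relation.Binary.Subset.Propositional {A = Cell} using (_⊆_)
import Data.List.Relation.Binary.Subset.Propositional.Properties as Subsetₚ
open import Data.List.Relation.Binary.Permutation.Propositional {A = Cell}
  using (_↭_; ↭-refl; ↭-sym; ↭-prep; ↭-swap; ↭-trans)
open import Data.List.Relation.Binary.Permutation.Propositional.Properties
  using (∈-resp-↭; ↭-length; ++⁺ʳ) renaming (shift to ↭-shift)
open import Relation.Binary.Definitions using (DecidableEquality)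
open import Relation.Binary.PropositionalEquality
  using (_≡_; _≢_; refl; sym; trans; cong; cong₂; subst; subst₂; module ≡-Reasoning)
open import Relation.Nullary using (¬_; Dec; yes; no; ¬?)
open import Relation.Nullary.Decidable using (from-yes; from-no; _×-dec_)
open import Function using (_∘_; case_of_)
open import Algebra.Properties.CommutativeSemigroup ℕₚ.+-commutativeSemigroup using (interchange)
open import Data.Bool using (Bool; true; false; not; _xor_)
import Data.Bool.Properties as Boolₚ

_≟ᶜ_ : DecidableEquality Cell
_≟ᶜ_ = ≡-dec ℤₚ._≟_ ℤₚ._≟_

open import Data.List.Membership.DecPropositional _≟ᶜ_ using (_∈?_)

suc≢ : ∀ i → sucℤ i ≢ i
suc≢ i e = ℤₚ.i≢suc[i] (sym e)

pred≢ : ∀ i → predℤ i ≢ i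
pred≢ i e = ℤₚ.i≢suc[i] (trans e (sym (ℤₚ.suc-pred i)))

pred≢suc : ∀ i → predℤ i ≢ sucℤ i
pred≢suc (+ zero) ()
pred≢suc (+ suc n) ()
pred≢suc -[1+ zero ] ()
pred≢suc -[1+ suc n ] ()

data Step : Set where
  back stay fwd : Step

Offset : Set
Offset = Step × Step

shift : Step → ℤ → ℤ
shift back = predℤ
shift stay i = i
shift fwd = sucℤ

_⊕_ : Cell → Offset → Cell
(x , y) ⊕ (dx , dy) = (shift dx x , shift dy y)

_≟ˢ_ : DecidableEquality Step
back ≟ˢ back = yes refl
back ≟ˢ stay = no λ ()
back ≟ˢ fwd  = no λ ()
stay ≟ˢ back = no λ ()
stay ≟ˢ stay = yes refl
stay ≟ˢ fwd  = no λ ()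
fwd  ≟ˢ back = no λ ()
fwd  ≟ˢ stay = no λ ()
fwd  ≟ˢ fwd  = yes refl

_≟ᵒ_ : DecidableEquality Offset
_≟ᵒ_ = ≡-dec _≟ˢ_ _≟ˢ_

open import Data.List.Membership.DecPropositional _≟ᵒ_ using () renaming (_∈?_ to _∈ᵒ?_)
open import Data.List.Relation.Unary.Unique.DecPropositional _≟ᵒ_ using (unique?)

shift-injective : ∀ {d d'} i → shift d i ≡ shift d' i → d ≡ d'
shift-injective {back} {back} i e = refl
shift-injective {back} {stay} i e = ⊥-elim (pred≢ i e)
shift-injective {back} {fwd}  i e = ⊥-elim (pred≢suc i e)
shift-injective {stay} {back} i e = ⊥-elim (pred≢ i (sym e))
shift-injective {stay} {stay} i e = refl
shift-injective {stay} {fwd}  i e = ⊥-elim (suc≢ i (sym e))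
shift-injective {fwd}  {back} i e = ⊥-elim (pred≢suc i (sym e))
shift-injective {fwd}  {stay} i e = ⊥-elim (suc≢ i e)
shift-injective {fwd}  {fwd}  i e = refl

⊕-injective : ∀ c {o o'} → c ⊕ o ≡ c ⊕ o' → o ≡ o'
⊕-injective (x , y) e =
  cong₂ _,_ (shift-injective x (cong proj₁ e)) (shift-injective y (cong proj₂ e))

squareOffsets : List Offset
squareOffsets = (stay , stay) ∷ (fwd , stay) ∷ (stay , fwd) ∷ (fwd , fwd) ∷ []

squareAt : Cell → List Cell
squareAt c = map (c ⊕_) squareOffsets

private
  _,≡_ : ∀ {x x' y y' : ℤ} → x ≡ x' → y ≡ y' → (x , y) ≡ (x' , y')
  _,≡_ = cong₂ _,_

  at : ∀ {M : List Cell} {c c'} → c ≡ c' → c ∈ M → c' ∈ M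
  at refl p = p

  0+ : ∀ t → + 0 Data.Integer.+ t ≡ t
  0+ = ℤₚ.+-identityˡ

  0+↺ : ∀ t → + 0 Data.Integer.+ t ≡ sucℤ (predℤ t)
  0+↺ t = trans (0+ t) (sym (ℤₚ.suc-pred t))

-- A set contains a copy of the square tetromino iff it contains some squareAt c:
-- each of the eight isometries maps P44 onto a 2×2 block (checked case by case).
square⇒contains : ∀ {M} c → All (_∈ M) (squareAt c) → Contains P44 M
square⇒contains (x , y) (a ∷ b ∷ c ∷ d ∷ []) =
  r0 , (x , y) , at (sym (0+ x ,≡ 0+ y)) a ∷ at (sym (refl ,≡ 0+ y)) b
               ∷ at (sym (0+ x ,≡ refl)) c ∷ d ∷ []

contains⇒square : ∀ {M} → Contains P44 M → ∃ λ c → All (_∈ M) (squareAt c)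
contains⇒square (r0 , (tx , ty) , a ∷ b ∷ c ∷ d ∷ []) = (tx , ty) ,
  at (0+ tx ,≡ 0+ ty) a ∷ at (refl ,≡ 0+ ty) b ∷ at (0+ tx ,≡ refl) c ∷ d ∷ []
contains⇒square (r90 , (tx , ty) , a ∷ b ∷ c ∷ d ∷ []) = (predℤ tx , ty) ,
  at (refl ,≡ 0+ ty) c ∷ at (0+↺ tx ,≡ 0+ ty) a ∷ d ∷ at (0+↺ tx ,≡ refl) b ∷ []
contains⇒square (r180 , (tx , ty) , a ∷ b ∷ c ∷ d ∷ []) = (predℤ tx , predℤ ty) ,
  d ∷ at (0+↺ tx ,≡ refl) c ∷ at (refl ,≡ 0+↺ ty) b ∷ at (0+↺ tx ,≡ 0+↺ ty) a ∷ []
contains⇒square (r270 , (tx , ty) , a ∷ b ∷ c ∷ d ∷ []) = (tx , predℤ ty) ,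
  at (0+ tx ,≡ refl) b ∷ d ∷ at (0+ tx ,≡ 0+↺ ty) a ∷ at (refl ,≡ 0+↺ ty) c ∷ []
contains⇒square (fx , (tx , ty) , a ∷ b ∷ c ∷ d ∷ []) = (tx , predℤ ty) ,
  at (0+ tx ,≡ refl) c ∷ d ∷ at (0+ tx ,≡ 0+↺ ty) a ∷ at (refl ,≡ 0+↺ ty) b ∷ []
contains⇒square (fy , (tx , ty) , a ∷ b ∷ c ∷ d ∷ []) = (predℤ tx , ty) ,
  at (refl ,≡ 0+ ty) b ∷ at (0+↺ tx ,≡ 0+ ty) a ∷ d ∷ at (0+↺ tx ,≡ refl) c ∷ []
contains⇒square (fd , (tx , ty) , a ∷ b ∷ c ∷ d ∷ []) = (tx , ty) ,
  at (0+ tx ,≡ 0+ ty) a ∷ at (refl ,≡ 0+ ty) c ∷ at (0+ tx ,≡ refl) b ∷ d ∷ []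
contains⇒square (fa , (tx , ty) , a ∷ b ∷ c ∷ d ∷ []) = (predℤ tx , predℤ ty) ,
  d ∷ at (0+↺ tx ,≡ refl) b ∷ at (refl ,≡ 0+↺ ty) c ∷ at (0+↺ tx ,≡ 0+↺ ty) a ∷ []

-- Far cells.  seed n = (n+1, 0) lies beyond every cell of L once n ≥ bound L;
-- seeds with separated indices have disjoint neighbourhoods (see below).
seed : ℕ → Cell
seed n = (+ suc n , + 0)

seed-injective : ∀ {n n'} → seed n ≡ seed n' → n ≡ n'
seed-injective e = ℕₚ.suc-injective (cong (∣_∣ ∘ proj₁) e)

bound : List Cell → ℕ
bound [] = 0
bound ((x , _) ∷ L) = ∣ x ∣ + bound L

bound-∈ : ∀ {c L} → c ∈ L → ∣ proj₁ c ∣ ≤ bound L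
bound-∈ {L = (x , _) ∷ L} (here refl) = ℕₚ.m≤m+n ∣ x ∣ (bound L)
bound-∈ {L = (x , _) ∷ L} (there p)   = ℕₚ.≤-trans (bound-∈ p) (ℕₚ.m≤n+m (bound L) ∣ x ∣)

seed∉ : ∀ {n L} → bound L ≤ n → seed n ∉ L
seed∉ le p = ℕₚ.<⇒≱ (s≤s le) (bound-∈ p)

Sep : ℕ → ℕ → Set
Sep n n' = n + 3 ≤ n' ⊎ n' + 3 ≤ n

Sep⇒≢ : ∀ {n n'} → Sep n n' → n ≢ n'
Sep⇒≢ (inj₁ le) refl = ℕₚ.<⇒≱ (ℕₚ.m<m+n _ (s≤s z≤n)) le
Sep⇒≢ (inj₂ le) refl = ℕₚ.<⇒≱ (ℕₚ.m<m+n _ (s≤s z≤n)) le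

spaced : ℕ → ℕ → List ℕ
spaced N zero    = []
spaced N (suc a) = N ∷ spaced (3 + N) a

length-spaced : ∀ N a → length (spaced N a) ≡ a
length-spaced N zero    = refl
length-spaced N (suc a) = cong suc (length-spaced (3 + N) a)

spaced-≥ : ∀ {N a n} → n ∈ spaced N a → N ≤ n
spaced-≥ {a = suc a} (here refl) = ℕₚ.≤-refl
spaced-≥ {N} {suc a} (there p)   = ℕₚ.≤-trans (ℕₚ.m≤n+m N 3) (spaced-≥ p)

spaced-sep : ∀ N a → AllPairs Sep (spaced N a)
spaced-sep N zero    = []
spaced-sep N (suc a) =
  All.tabulate (λ p → inj₁ (ℕₚ.≤-trans (ℕₚ.≤-reflexive (ℕₚ.+-comm N 3)) (spaced-≥ p)))
  ∷ spaced-sep (3 + N) a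

farCells : List Cell → ℕ → List Cell
farCells L a = map seed (spaced (2 + bound L) a)

farCells-fresh : ∀ L a → Unique (farCells L a) × All (_∉ L) (farCells L a)
farCells-fresh L a =
  Uniqueₚ.map⁺ seed-injective (AllPairs.map Sep⇒≢ (spaced-sep (2 + bound L) a)) ,
  All.tabulate λ p → let (n , n∈ , e) = ∈-map⁻ seed p in
                     subst (_∉ L) (sym e) (seed∉ (ℕₚ.≤-trans (ℕₚ.m≤n+m _ 2) (spaced-≥ n∈)))

extend : ∀ K L {b} → length K ≤ b → Unique K → All (_∉ L) K →
         ∃ λ k → length k ≡ b × Unique k × All (_∉ L) k × K ⊆ k
extend K L {b} K≤b uK K∉L = K ++ F , len , uk , Allₚ.++⁺ K∉L (All.map (_∘ ∈-++⁺ʳ K) F∉) , ∈-++⁺ˡ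
  where
  N = 2 + bound (K ++ L)
  j = b ∸ length K
  F = farCells (K ++ L) j
  uF = proj₁ (farCells-fresh (K ++ L) j)
  F∉ = proj₂ (farCells-fresh (K ++ L) j)
  uk : Unique (K ++ F)
  uk = Uniqueₚ.++⁺ uK uF (λ (c∈K , c∈F) → All.lookup F∉ c∈F (∈-++⁺ˡ c∈K))
  len : length (K ++ F) ≡ b
  len = trans (length-++ K) (trans (cong (_+_ (length K))
          (trans (length-map seed (spaced N j)) (length-spaced N j))) (ℕₚ.m+[n∸m]≡n K≤b))

unmarked : ∀ {c : Cell} {M B} → c ∉ M ++ B → c ∉ M × c ∉ B
unmarked c∉ = c∉ ∘ ∈-++⁺ˡ , c∉ ∘ ∈-++⁺ʳ _

marked : ∀ {c : Cell} {M B} → c ∉ M × c ∉ B → c ∉ M ++ B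
marked {M = M} (c∉M , c∉B) p = [ c∉M , c∉B ]′ (∈-++⁻ M p)

disjoint-step : ∀ {M B m k : List Cell} → Disjoint M B → All (λ c → c ∉ M × c ∉ B) m →
                All (λ c → c ∉ m ++ M × c ∉ B) k → Disjoint (m ++ M) (k ++ B)
disjoint-step {m = m} {k} dj fm fk (c∈mM , c∈kB) with ∈-++⁻ k c∈kB
... | inj₁ c∈k = proj₁ (All.lookup fk c∈k) c∈mM
... | inj₂ c∈B with ∈-++⁻ m c∈mM
...   | inj₁ c∈m = proj₂ (All.lookup fm c∈m) c∈B
...   | inj₂ c∈M = dj (c∈M , c∈B)

-- If Inv is monotone in breaker's cells,
-- rules out a copy of A among maker's cells (when the marks are disjoint), and every
-- maker move can be answered by at most b fresh cells restoring it, then A is an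
-- (a,b)-loser: breaker pads each answer to exactly b cells with far cells.
invariantLoser : ∀ {A a b} (Inv : List Cell → List Cell → Set) →
  (∀ {M B B'} → B ⊆ B' → Inv M B → Inv M B') →
  (∀ {M B} → Disjoint M B → Inv M B → ¬ Contains A M) →
  (∀ {M B} m → Inv M B → length m ≡ a → Fresh m M B →
     ∃ λ K → length K ≤ b × Fresh K (m ++ M) B × Inv (m ++ M) (K ++ B)) →
  Inv [] [] → Loser A a b
invariantLoser {A} {a} {b} Inv mono safe respond = never (λ ())
  where
  reply : ∀ {M B} m → Disjoint M B → Inv M B → length m ≡ a → Fresh m M B →
          ∃ λ k → length k ≡ b × Fresh k (m ++ M) B ×
                  Disjoint (m ++ M) (k ++ B) × Inv (m ++ M) (k ++ B)
  reply {M} {B} m dj inv lm fm with respond m inv lm fm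
  ... | K , K≤b , (uK , K∉) , invK with extend K ((m ++ M) ++ B) K≤b uK (All.map marked K∉)
  ... | k , lk , uk , k∉ , K⊆k =
    k , lk , (uk , All.map unmarked k∉) ,
    disjoint-step dj (proj₂ fm) (All.map unmarked k∉) , mono (Subsetₚ.++⁺ˡ B K⊆k) invK

  never : ∀ {M B} → Disjoint M B → Inv M B → ¬ MakerWins A a b M B
  never dj inv (move m lm fm (inj₁ won)) with reply m dj inv lm fm
  ... | _ , _ , _ , dj' , inv' = safe dj' inv' won
  never dj inv (move m lm fm (inj₂ next)) with reply m dj inv lm fm
  ... | k , lk , fk , dj' , inv' = never dj' inv' (next k lk fk)

-- Breaker answers each maker cell c by
-- π c (if still needed), so maker never owns both cells of a pair.
pairingLoser : ∀ {A b} (π : Cell → Cell) → (∀ c → π (π c) ≡ c) → (∀ c → π c ≢ c) →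
  (∀ {M} → Contains A M → ∃ λ c → c ∈ M × π c ∈ M) → 1 ≤ b → Loser A 1 b
pairingLoser {A} {b} π involutive no-fixpoint pairIn 1≤b =
  invariantLoser Paired (λ B⊆B' paired → B⊆B' ∘ paired) safe respond (λ ())
  where
  Paired : List Cell → List Cell → Set
  Paired M B = ∀ {c} → c ∈ M → π c ∈ B

  safe : ∀ {M B} → Disjoint M B → Paired M B → ¬ Contains A M
  safe dj paired won with pairIn won
  ... | c , c∈M , πc∈M = dj (πc∈M , paired c∈M)

  respond : ∀ {M B} m → Paired M B → length m ≡ 1 → Fresh m M B →
            ∃ λ K → length K ≤ b × Fresh K (m ++ M) B × Paired (m ++ M) (K ++ B)
  respond {M} {B} (p ∷ []) paired refl (_ , (_ , p∉B) ∷ []) with π p ∈? B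
  ... | yes πp∈B = [] , z≤n , ([] , []) , λ { (here refl) → πp∈B ; (there c∈M) → paired c∈M }
  ... | no  πp∉B = π p ∷ [] , 1≤b , ([] ∷ [] , (πp∉ , πp∉B) ∷ []) ,
                   λ { (here refl) → here refl ; (there c∈M) → there (paired c∈M) }
    where
    πp∉ : π p ∉ p ∷ M
    πp∉ (here e)     = no-fixpoint p e
    πp∉ (there πp∈M) = p∉B (subst (_∈ B) (involutive p) (paired πp∈M))

-- The domino tiling used against (1,1).  Colour cells by the parity of x + y and pair
-- each cell with its right neighbour if it has colour false, its left one otherwise.
evenℕ : ℕ → Bool
evenℕ zero    = true
evenℕ (suc n) = not (evenℕ n)

evenℤ : ℤ → Bool
evenℤ (+ n)      = evenℕ n
evenℤ -[1+ n ]   = not (evenℕ n)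

evenℤ-suc : ∀ i → evenℤ (sucℤ i) ≡ not (evenℤ i)
evenℤ-suc (+ n)            = refl
evenℤ-suc -[1+ zero ]      = refl
evenℤ-suc -[1+ suc n ]     = sym (Boolₚ.not-involutive _)

colour : Cell → Bool
colour (x , y) = evenℤ x xor evenℤ y

colour-sucˣ : ∀ x y → colour (sucℤ x , y) ≡ not (colour (x , y))
colour-sucˣ x y rewrite evenℤ-suc x = sym (Boolₚ.not-distribˡ-xor (evenℤ x) (evenℤ y))

colour-sucʸ : ∀ x y → colour (x , sucℤ y) ≡ not (colour (x , y))
colour-sucʸ x y rewrite evenℤ-suc y = sym (Boolₚ.not-distribʳ-xor (evenℤ x) (evenℤ y))

horizontal : Bool → Cell → Cell
horizontal true  (x , y) = (predℤ x , y)
horizontal false (x , y) = (sucℤ x , y)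

partner : Cell → Cell
partner c = horizontal (colour c) c

-- Right neighbours of false cells are true cells and conversely, so pairing is involutive.
partner-involutive : ∀ c → partner (partner c) ≡ c
partner-involutive (x , y) with colour (x , y) in eq
... | false = trans (cong (λ b → horizontal b (sucℤ x , y)) (trans (colour-sucˣ x y) (cong not eq)))
                    (cong (_, y) (ℤₚ.pred-suc x))
... | true  = trans (cong (λ b → horizontal b (predℤ x , y)) left-colour)
                    (cong (_, y) (ℤₚ.suc-pred x))
  where
  left-colour : colour (predℤ x , y) ≡ false
  left-colour = Boolₚ.not-injective (begin
    not (colour (predℤ x , y))           ≡⟨ sym (colour-sucˣ (predℤ x) y) ⟩
    colour (sucℤ (predℤ x) , y)         ≡⟨ cong (λ z → colour (z , y)) (ℤₚ.suc-pred x) ⟩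
    colour (x , y)                       ≡⟨ eq ⟩
    true                                 ∎)
    where open ≡-Reasoning

partner-no-fixpoint : ∀ c → partner c ≢ c
partner-no-fixpoint (x , y) e with colour (x , y)
... | true  = pred≢ x (cong proj₁ e)
... | false = suc≢ x (cong proj₁ e)

-- Every 2×2 square contains a domino of the tiling: the bottom row if its left cell
-- has colour false, otherwise the top row.
square-has-domino : ∀ {M} c → All (_∈ M) (squareAt c) → ∃ λ d → d ∈ M × partner d ∈ M
square-has-domino (i , j) (ll ∷ lr ∷ ul ∷ ur ∷ []) with colour (i , j) in eq
... | false = (i , j) , ll , subst (λ b → horizontal b (i , j) ∈ _) (sym eq) lr
... | true  = (i , sucℤ j) , ul ,
              subst (λ b → horizontal b (i , sucℤ j) ∈ _)
                    (sym (trans (colour-sucʸ i j) (cong not eq))) ur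

loser11 : Loser P44 1 1
loser11 = pairingLoser partner partner-involutive partner-no-fixpoint
            (λ won → let (c , sq) = contains⇒square won in square-has-domino c sq) ℕₚ.≤-refl

-- Covering.  The four squares containing c have lower-left corners c + (0 or -1, 0 or -1).
cornerOffsets : List Offset
cornerOffsets = (stay , stay) ∷ (back , stay) ∷ (stay , back) ∷ (back , back) ∷ []

cornersOf : Cell → List Cell
cornersOf c = map (c ⊕_) cornerOffsets

corner-of-member : ∀ {n k} → n ∈ squareAt k → k ∈ cornersOf n
corner-of-member {k = x , y} (here refl)                     = here refl
corner-of-member {k = x , y} (there (here refl))             =
  there (here (sym (ℤₚ.pred-suc x ,≡ refl)))
corner-of-member {k = x , y} (there (there (here refl)))     =
  there (there (here (sym (refl ,≡ ℤₚ.pred-suc y))))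
corner-of-member {k = x , y} (there (there (there (here refl)))) =
  there (there (there (here (sym (ℤₚ.pred-suc x ,≡ ℤₚ.pred-suc y)))))

Blocked : List Cell → Cell → Set
Blocked B k = Any (_∈ B) (squareAt k)

Covered : List Cell → List Cell → Set
Covered M B = ∀ {c} → c ∈ M → All (Blocked B) (cornersOf c)

covered-⊆ : ∀ {M M' B B'} → M' ⊆ M → B ⊆ B' → Covered M B → Covered M' B'
covered-⊆ M'⊆M B⊆B' cov = All.map (Any.map B⊆B') ∘ cov ∘ M'⊆M

covered-safe : ∀ {M B} → Disjoint M B → Covered M B → ¬ Contains P44 M
covered-safe dj cov won with contains⇒square won
... | k , sq@(k∈M ∷ _) with All.lookupAny sq (All.lookup (cov k∈M) (here refl))
... | c∈M , c∈B = dj (c∈M , c∈B)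

blocked-via : ∀ {M B n k} → Covered M B → n ∈ M ⊎ n ∈ B → n ∈ squareAt k → Blocked B k
blocked-via cov (inj₁ n∈M) n∈sq = All.lookup (cov n∈M) (corner-of-member n∈sq)
blocked-via cov (inj₂ n∈B) n∈sq = Any.map (λ e → subst (_∈ _) e n∈B) n∈sq

data Axis : Set where
  H V : Axis

axisOffsets : Axis → List Offset
axisOffsets H = (back , stay) ∷ (fwd , stay) ∷ []
axisOffsets V = (stay , back) ∷ (stay , fwd) ∷ []

neighbours : Axis → Cell → List Cell
neighbours ax c = map (c ⊕_) (axisOffsets ax)

axis-meets-squares : ∀ ax p → All (λ k → Any (_∈ squareAt k) (neighbours ax p)) (cornersOf p)
axis-meets-squares H (x , y) =
  there (here (there (here refl))) ∷ here (here refl) ∷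
  there (here (there (there (there (here (refl ,≡ sym (ℤₚ.suc-pred y))))))) ∷
  here (there (there (here (refl ,≡ sym (ℤₚ.suc-pred y))))) ∷ []
axis-meets-squares V (x , y) =
  there (here (there (there (here refl)))) ∷
  there (here (there (there (there (here (sym (ℤₚ.suc-pred x) ,≡ refl)))))) ∷
  here (here refl) ∷ here (there (here (sym (ℤₚ.suc-pred x) ,≡ refl))) ∷ []

covered-by-neighbours : ∀ {M B} ax p → Covered M B →
  All (λ n → n ∈ M ⊎ n ∈ B) (neighbours ax p) → All (Blocked B) (cornersOf p)
covered-by-neighbours ax p cov marks =
  All.map (All.lookupWith (λ mark n∈sq → blocked-via cov mark n∈sq) marks) (axis-meets-squares ax p)

vertical-keeps-x : ∀ {p n} → n ∈ neighbours V p → proj₁ n ≡ proj₁ p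
vertical-keeps-x (here refl)         = refl
vertical-keeps-x (there (here refl)) = refl

horizontal-moves-x : ∀ {p n} → n ∈ neighbours H p → proj₁ n ≢ proj₁ p
horizontal-moves-x {x , _} (here refl)         = pred≢ x
horizontal-moves-x {x , _} (there (here refl)) = suc≢ x

HV-disjoint : ∀ p → Disjoint (neighbours H p) (neighbours V p)
HV-disjoint p (n∈H , n∈V) = horizontal-moves-x n∈H (vertical-keeps-x {p} n∈V)

neighbour≢ : ∀ {ax p n} → n ∈ neighbours ax p → n ≢ p
neighbour≢ {H} n∈ refl = horizontal-moves-x n∈ refl
neighbour≢ {V} {x , y} (here e)         = pred≢ y ∘ cong proj₂ ∘ trans (sym e)
neighbour≢ {V} {x , y} (there (here e)) = suc≢ y ∘ cong proj₂ ∘ trans (sym e)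

length-neighbours : ∀ ax p → length (neighbours ax p) ≡ 2
length-neighbours H p = refl
length-neighbours V p = refl

neighbours-unique : ∀ ax p → Unique (neighbours ax p)
neighbours-unique ax p = Uniqueₚ.map⁺ (⊕-injective p) (unique ax)
  where
  unique : ∀ ax → Unique (axisOffsets ax)
  unique H = ((λ ()) ∷ []) ∷ [] ∷ []
  unique V = ((λ ()) ∷ []) ∷ [] ∷ []

newNeighbours : Axis → Cell → List Cell → List Cell
newNeighbours ax p L = filter (λ c → ¬? (c ∈? L)) (neighbours ax p)

newNeighbours-∈ : ∀ {ax p L c} → c ∈ newNeighbours ax p L → c ∈ neighbours ax p × c ∉ L
newNeighbours-∈ {ax} {p} {L} = ∈-filter⁻ (λ c → ¬? (c ∈? L)) {xs = neighbours ax p}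

coverCell : ∀ ax p {M B} → Covered M B → Covered (p ∷ M) (newNeighbours ax p (M ++ B) ++ B)
coverCell ax p {M} {B} cov (here refl) =
  covered-by-neighbours ax p (covered-⊆ (λ c∈ → c∈) (∈-++⁺ʳ K) cov) (All.tabulate marked?)
  where
  K = newNeighbours ax p (M ++ B)
  marked? : ∀ {n} → n ∈ neighbours ax p → n ∈ M ⊎ n ∈ K ++ B
  marked? {n} n∈ with n ∈? M ++ B
  ... | yes n∈MB = Sum.map₂ (∈-++⁺ʳ K) (∈-++⁻ M n∈MB)
  ... | no  n∉MB = inj₂ (∈-++⁺ˡ (∈-filter⁺ (λ c → ¬? (c ∈? M ++ B)) n∈ n∉MB))
coverCell ax p {M} {B} cov (there c∈M) =
  All.map (Any.map (∈-++⁺ʳ (newNeighbours ax p (M ++ B)))) (cov c∈M)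

data Plan : List Cell → Set where
  done : Plan []
  next : ∀ {p rest} ax → Disjoint (neighbours ax p) rest → Plan rest → Plan (p ∷ rest)

coverPlan : ∀ {ord M B} → Plan ord → Covered M B →
  ∃ λ K → Unique K × All (λ c → c ∉ ord ++ M × c ∉ B) K ×
          length K ≤ 2 * length ord × Covered (ord ++ M) (K ++ B)
coverPlan done cov = [] , [] , [] , z≤n , cov
coverPlan {p ∷ rest} {M} {B} (next ax avoids plan) cov with coverPlan plan (coverCell ax p cov)
... | K₂ , uK₂ , K₂∉ , lenK₂ , cov₂ =
  K₂ ++ K₁ , uK , Allₚ.++⁺ (All.map old K₂∉) (All.tabulate new) , lenK ,
  covered-⊆ reorder reassoc cov₂
  where
  K₁ = newNeighbours ax p (M ++ B)
  reorder : (p ∷ rest) ++ M ⊆ rest ++ p ∷ M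
  reorder = ∈-resp-↭ (↭-sym (↭-shift p rest M))
  reassoc : K₂ ++ K₁ ++ B ⊆ (K₂ ++ K₁) ++ B
  reassoc = subst (_ ∈_) (sym (++-assoc K₂ K₁ B))
  uK : Unique (K₂ ++ K₁)
  uK = Uniqueₚ.++⁺ uK₂ (Uniqueₚ.filter⁺ (λ c → ¬? (c ∈? M ++ B)) (neighbours-unique ax p))
         (λ (c∈K₂ , c∈K₁) → proj₂ (All.lookup K₂∉ c∈K₂) (∈-++⁺ˡ c∈K₁))
  old : ∀ {c} → c ∉ rest ++ p ∷ M × c ∉ K₁ ++ B → c ∉ (p ∷ rest) ++ M × c ∉ B
  old (c∉ , c∉K₁B) = c∉ ∘ reorder , c∉K₁B ∘ ∈-++⁺ʳ K₁
  new : ∀ {c} → c ∈ K₁ → c ∉ (p ∷ rest) ++ M × c ∉ B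
  new c∈K₁ with newNeighbours-∈ {ax} c∈K₁
  ... | c∈nb , c∉MB =
    (λ { (here refl) → neighbour≢ c∈nb refl
       ; (there c∈)  → [ (λ c∈rest → avoids (c∈nb , c∈rest)) , c∉MB ∘ ∈-++⁺ˡ ]′ (∈-++⁻ rest c∈) })
    , c∉MB ∘ ∈-++⁺ʳ M
  lenK : length (K₂ ++ K₁) ≤ 2 * length (p ∷ rest)
  lenK = begin
    length (K₂ ++ K₁)              ≡⟨ length-++ K₂ ⟩
    length K₂ + length K₁
      ≤⟨ ℕₚ.+-mono-≤ lenK₂ (length-filter (λ c → ¬? (c ∈? M ++ B)) (neighbours ax p)) ⟩
    2 * length rest + length (neighbours ax p)
      ≡⟨ cong (_+_ (2 * length rest)) (length-neighbours ax p) ⟩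
    2 * length rest + 2            ≡⟨ ℕₚ.+-comm (2 * length rest) 2 ⟩
    2 + 2 * length rest            ≡⟨ sym (ℕₚ.*-suc 2 (length rest)) ⟩
    2 * length (p ∷ rest)          ∎
    where open ℕₚ.≤-Reasoning

Plannable : List Cell → Set
Plannable m = ∃ λ ord → ord ↭ m × Plan ord

avoiding : ∀ {N : List Cell} {q r} → q ∉ N → r ∉ N → Disjoint N (q ∷ r ∷ [])
avoiding q∉ r∉ (n∈ , here refl)         = q∉ n∈
avoiding q∉ r∉ (n∈ , there (here refl)) = r∉ n∈

-- One of the two axes of p avoids q, since the horizontal and vertical neighbours differ.
plan₂ : ∀ p q → Plan (p ∷ q ∷ [])
plan₂ p q with q ∈? neighbours H p
... | yes q∈H = next V (λ { (n∈ , here refl) → HV-disjoint p (q∈H , n∈) }) (next H (λ ()) done)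
... | no  q∉H = next H (λ { (n∈ , here refl) → q∉H n∈ }) (next H (λ ()) done)

-- If q is a horizontal and r a vertical neighbour of p, then the vertical neighbours of q
-- (same x as q) avoid both p and r (same x as p).
corner : ∀ {p q r} → q ∈ neighbours H p → r ∈ neighbours V p →
         Disjoint (neighbours V q) (p ∷ r ∷ [])
corner {p} {q} q∈H r∈V (n∈ , here refl) =
  horizontal-moves-x q∈H (sym (vertical-keeps-x {q} n∈))
corner {p} {q} q∈H r∈V (n∈ , there (here refl)) =
  horizontal-moves-x q∈H (trans (sym (vertical-keeps-x {q} n∈)) (vertical-keeps-x {p} r∈V))

-- Three cells: start with p along an axis avoiding q and r if there is one; otherwise
-- one of q, r is a horizontal and the other a vertical neighbour of p, and the
-- horizontal one can start instead.
plan₃ : ∀ p q r → Plannable (p ∷ q ∷ r ∷ [])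
plan₃ p q r with q ∈? neighbours H p | r ∈? neighbours H p
... | no q∉H | no r∉H = _ , ↭-refl , next H (avoiding q∉H r∉H) (plan₂ q r)
... | yes q∈H | _ with r ∈? neighbours V p
...   | yes r∈V = _ , ↭-swap q p ↭-refl , next V (corner q∈H r∈V) (plan₂ p r)
...   | no  r∉V = _ , ↭-refl , next V (avoiding (λ q∈V → HV-disjoint p (q∈H , q∈V)) r∉V) (plan₂ q r)
plan₃ p q r | no q∉H | yes r∈H with q ∈? neighbours V p
...   | yes q∈V = _ , ↭-trans (↭-swap r p ↭-refl) (↭-prep p (↭-swap r q ↭-refl)) ,
                  next V (corner r∈H q∈V) (plan₂ p q)
...   | no  q∉V = _ , ↭-refl , next V (avoiding q∉V (λ r∈V → HV-disjoint p (r∈H , r∈V))) (plan₂ q r)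

plannable : ∀ m → length m ≤ 3 → Plannable m
plannable []                  _ = _ , ↭-refl , done
plannable (p ∷ [])            _ = _ , ↭-refl , next H (λ ()) done
plannable (p ∷ q ∷ [])        _ = _ , ↭-refl , plan₂ p q
plannable (p ∷ q ∷ r ∷ [])    _ = plan₃ p q r
plannable (_ ∷ _ ∷ _ ∷ _ ∷ _) (s≤s (s≤s (s≤s ())))

coverLoser : ∀ {a b} → a ≤ 3 → 2 * a ≤ b → Loser P44 a b
coverLoser {a} {b} a≤3 2a≤b =
  invariantLoser Covered (covered-⊆ (λ c∈ → c∈)) covered-safe respond (λ ())
  where
  respond : ∀ {M B} m → Covered M B → length m ≡ a → Fresh m M B →
            ∃ λ K → length K ≤ b × Fresh K (m ++ M) B × Covered (m ++ M) (K ++ B)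
  respond {M} m cov lm _ with plannable m (subst (_≤ 3) (sym lm) a≤3)
  ... | ord , ord↭m , plan with coverPlan plan cov
  ... | K , uK , K∉ , lenK , covK =
    K , lenK' , (uK , All.map (λ (c∉ , c∉B) → c∉ ∘ m⊆ord , c∉B) K∉) ,
    covered-⊆ m⊆ord (λ c∈ → c∈) covK
    where
    m⊆ord : m ++ M ⊆ ord ++ M
    m⊆ord = ∈-resp-↭ (++⁺ʳ M (↭-sym ord↭m))
    lenK' : length K ≤ b
    lenK' = ℕₚ.≤-trans lenK (subst (λ l → 2 * l ≤ b) (sym (trans (↭-length ord↭m) lm)) 2a≤b)

loser24 : Loser P44 2 4
loser24 = coverLoser (s≤s (s≤s z≤n)) ℕₚ.≤-refl

loser36 : Loser P44 3 6
loser36 = coverLoser ℕₚ.≤-refl ℕₚ.≤-refl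

origin : Cell
origin = (+ 0 , + 0)

squareAt-unique : ∀ c → Unique (squareAt c)
squareAt-unique c = Uniqueₚ.map⁺ (⊕-injective c) offsets-unique
  where
  offsets-unique : Unique squareOffsets
  offsets-unique = from-yes (unique? squareOffsets)

winner≥4 : ∀ n b → n ≥ 4 → Winner P44 n b
winner≥4 n b n≥4 with extend (squareAt origin) [] n≥4 (squareAt-unique origin) (All.tabulate λ _ ())
... | k , lk , uk , _ , sq⊆k =
  move k lk (uk , All.tabulate (λ _ → (λ ()) , (λ ())))
       (inj₁ (square⇒contains origin (All.tabulate (∈-++⁺ˡ ∘ sq⊆k))))

contains-mono : ∀ {A X Y} → X ⊆ Y → Contains A X → Contains A Y
contains-mono X⊆Y (g , t , cells) = g , t , All.map X⊆Y cells

silentBreaker : ∀ {A M} c K → Unique (c ∷ K) → All (_∉ M) (c ∷ K) →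
                Contains A ((c ∷ K) ++ M) → MakerWins A 1 0 M []
silentBreaker c [] _ (c∉M ∷ []) won = move (c ∷ []) refl ([] ∷ [] , (c∉M , λ ()) ∷ []) (inj₁ won)
silentBreaker {M = M} c (c' ∷ K) (c≢ ∷ uK) (c∉M ∷ K∉M) won =
  move (c ∷ []) refl ([] ∷ [] , (c∉M , λ ()) ∷ []) (inj₂ λ
    { [] refl _ → silentBreaker c' K uK (All.zipWith fresh (c≢ , K∉M))
                    (contains-mono (∈-resp-↭ (↭-sym (↭-shift c (c' ∷ K) M))) won) })
  where
  fresh : ∀ {x} → c ≢ x × x ∉ M → x ∉ c ∷ M
  fresh (c≢x , _)   (here x≡c)  = c≢x (sym x≡c)
  fresh (_ , x∉M) (there x∈M) = x∉M x∈M

winner10 : Winner P44 1 0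
winner10 = silentBreaker _ _ (squareAt-unique origin) (All.tabulate λ _ ())
             (square⇒contains origin (All.tabulate ∈-++⁺ˡ))

allOffsets : List Offset
allOffsets = (back , back) ∷ (back , stay) ∷ (back , fwd) ∷ (stay , back) ∷ (stay , stay)
           ∷ (stay , fwd) ∷ (fwd , back) ∷ (fwd , stay) ∷ (fwd , fwd) ∷ []

offset∈all : ∀ o → o ∈ allOffsets
offset∈all (back , back) = here refl
offset∈all (back , stay) = there (here refl)
offset∈all (back , fwd)  = there (there (here refl))
offset∈all (stay , back) = there (there (there (here refl)))
offset∈all (stay , stay) = there (there (there (there (here refl))))
offset∈all (stay , fwd)  = there (there (there (there (there (here refl)))))
offset∈all (fwd , back)  = there (there (there (there (there (there (here refl))))))
offset∈all (fwd , stay)  = there (there (there (there (there (there (there (here refl)))))))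
offset∈all (fwd , fwd)   = there (there (there (there (there (there (there (there (here refl))))))))

nbhd : Cell → List Cell
nbhd c = map (c ⊕_) allOffsets

⊕∈nbhd : ∀ c o → c ⊕ o ∈ nbhd c
⊕∈nbhd c o = ∈-map⁺ (c ⊕_) (offset∈all o)

-- Neighbourhoods of seeds with separated indices are disjoint: the neighbourhood of
-- seed n lies in the columns n, n+1, n+2.
seed-nbhd-x : ∀ {n c} → c ∈ nbhd (seed n) → n ≤ ∣ proj₁ c ∣ × ∣ proj₁ c ∣ ≤ 2 + n
seed-nbhd-x {n} c∈ with ∈-map⁻ (seed n ⊕_) {xs = allOffsets} c∈
... | (back , _) , _ , refl = ℕₚ.≤-refl , ℕₚ.m≤n+m n 2
... | (stay , _) , _ , refl = ℕₚ.n≤1+n n , ℕₚ.n≤1+n (suc n)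
... | (fwd  , _) , _ , refl = ℕₚ.m≤n+m n 2 , ℕₚ.≤-refl

sep-apart : ∀ {n n'} → Sep n n' → Disjoint (nbhd (seed n)) (nbhd (seed n'))
sep-apart (inj₁ le) (c∈ , c∈') = left-of le c∈ c∈'
  where
  left-of : ∀ {n n' c} → n + 3 ≤ n' → c ∈ nbhd (seed n) → c ∉ nbhd (seed n')
  left-of {n} le c∈ c∈' = ℕₚ.<⇒≱
    (ℕₚ.≤-trans (s≤s (proj₂ (seed-nbhd-x c∈))) (ℕₚ.≤-trans (ℕₚ.≤-reflexive (ℕₚ.+-comm 3 n)) le))
    (proj₁ (seed-nbhd-x c∈'))
sep-apart (inj₂ le) (c∈ , c∈') = sep-apart (inj₁ le) (c∈' , c∈)

Seeded : List ℕ → List Cell → Set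
Seeded ns M = M ≡ map seed ns × AllPairs Sep ns

equal-or-sep : ∀ {ns n n'} → AllPairs Sep ns → n ∈ ns → n' ∈ ns → n ≡ n' ⊎ Sep n n'
equal-or-sep _        (here refl) (here refl) = inj₁ refl
equal-or-sep (s ∷ _)  (here refl) (there q)   = inj₂ (All.lookup s q)
equal-or-sep (s ∷ _)  (there p)   (here refl) = inj₂ (Sum.swap (All.lookup s p))
equal-or-sep (_ ∷ ss) (there p)   (there q)   = equal-or-sep ss p q

seed-alone : ∀ {ns M n} → Seeded ns M → n ∈ ns → ∀ o → seed n ⊕ o ∈ M → o ≡ (stay , stay)
seed-alone {n = n} (refl , sep) n∈ o c∈ with ∈-map⁻ seed c∈
... | n' , n'∈ , e with equal-or-sep sep n∈ n'∈
... | inj₁ refl = ⊕-injective (seed n) e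
... | inj₂ s    = ⊥-elim (sep-apart s (⊕∈nbhd (seed n) o ,
                            subst (_∈ nbhd (seed n')) (sym e) (⊕∈nbhd (seed n') (stay , stay))))

-- Seeding phase.  For r turns maker marks a new seeds, beyond all marked cells and
-- separated from each other and from the old seeds; then `finish` takes over.
seeding : ∀ {A a b} r {ns M B} → Seeded ns M →
  (∀ {ns' M' B'} → Seeded ns' M' → length ns' ≡ r * a + length ns →
                   length B' ≡ r * b + length B → MakerWins A a b M' B') →
  MakerWins A a b M B
seeding zero sd finish = finish sd refl refl
seeding {a = a} {b} (suc r) {ns} {M} {B} (M≡ , sep) finish =
  move new (trans (length-map seed idx) (length-spaced _ a)) fresh
    (inj₂ λ k lk _ → seeding r (seeded , sep') λ sd l₁ l₂ →
       finish sd (laterTurns a l₁ length-idx++)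
                 (laterTurns b l₂ (trans (length-++ k) (cong (_+ length B) lk))))
  where
  β = bound (M ++ B)
  idx = spaced (2 + β) a
  new = map seed idx
  fresh : Fresh new M B
  fresh = let (u , f) = farCells-fresh (M ++ B) a in u , All.map unmarked f
  length-idx++ : length (idx ++ ns) ≡ a + length ns
  length-idx++ = trans (length-++ idx) (cong (_+ length ns) (length-spaced _ a))
  laterTurns : ∀ c {l m n} → l ≡ r * c + m → m ≡ c + n → l ≡ suc r * c + n
  laterTurns c {n = n} l≡ refl =
    trans l≡ (trans (sym (ℕₚ.+-assoc (r * c) c n)) (cong (_+ n) (ℕₚ.+-comm (r * c) c)))
  seeded : new ++ M ≡ map seed (idx ++ ns)
  seeded = trans (cong (new ++_) M≡) (sym (map-++ seed idx ns))
  -- old seeds have index below β, new ones at least 2 + β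
  old<β : ∀ {n} → n ∈ ns → suc n ≤ β
  old<β n∈ = bound-∈ (∈-++⁺ˡ (subst (seed _ ∈_) (sym M≡) (∈-map⁺ seed n∈)))
  sep' : AllPairs Sep (idx ++ ns)
  sep' = AllPairsₚ.++⁺ (spaced-sep (2 + β) a) sep (All.tabulate λ i∈ → All.tabulate λ {n} n∈ →
           inj₂ (ℕₚ.≤-trans (ℕₚ.≤-reflexive (ℕₚ.+-comm n 3))
                            (ℕₚ.≤-trans (s≤s (s≤s (old<β n∈))) (spaced-≥ i∈))))

hits : List Cell → List Cell → ℕ
hits R B = length (filter (_∈? R) B)

hits-∷ : ∀ R b B → hits R (b ∷ B) ≡ hits R (b ∷ []) + hits R B
hits-∷ R b B with b ∈? R
... | yes _ = refl
... | no  _ = refl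

no-hits : ∀ {R B c} → hits R B ≤ 0 → c ∈ R → c ∉ B
no-hits {R} le c∈R c∈B = ℕₚ.<-irrefl refl (ℕₚ.≤-trans (nonempty (∈-filter⁺ (_∈? R) c∈B c∈R)) le)
  where
  nonempty : ∀ {c : Cell} {xs} → c ∈ xs → 0 < length xs
  nonempty (here _)  = s≤s z≤n
  nonempty (there _) = s≤s z≤n

module Pigeonhole {I : Set} (region : I → List Cell) where

  Apart : I → I → Set
  Apart i j = Disjoint (region i) (region j)

  total : List I → List Cell → ℕ
  total []       B = 0
  total (i ∷ is) B = hits (region i) B + total is B

  private
    total-[] : ∀ is → total is [] ≡ 0
    total-[] []       = refl
    total-[] (_ ∷ is) = total-[] is

    total-∷ : ∀ is b B → total is (b ∷ B) ≡ total is (b ∷ []) + total is B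
    total-∷ []       b B = refl
    total-∷ (i ∷ is) b B =
      trans (cong₂ _+_ (hits-∷ (region i) b B) (total-∷ is b B))
            (interchange (hits (region i) (b ∷ [])) _ _ _)

    total-outside : ∀ {b} is → All (λ i → b ∉ region i) is → total is (b ∷ []) ≡ 0
    total-outside []       []          = refl
    total-outside {b} (i ∷ is) (b∉ ∷ b∉s) with b ∈? region i
    ... | yes b∈ = ⊥-elim (b∉ b∈)
    ... | no  _  = total-outside is b∉s

    total-single : ∀ {b} is → AllPairs Apart is → total is (b ∷ []) ≤ 1
    total-single []       _ = z≤n
    total-single {b} (i ∷ is) (apart ∷ aps) with b ∈? region i
    ... | yes b∈ =
      s≤s (ℕₚ.≤-reflexive (total-outside is (All.map (λ ap b∈j → ap (b∈ , b∈j)) apart)))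
    ... | no  _  = total-single is aps

  total≤ : ∀ {is} → AllPairs Apart is → ∀ B → total is B ≤ length B
  total≤ {is} _   []      = ℕₚ.≤-reflexive (total-[] is)
  total≤ {is} aps (b ∷ B) = ℕₚ.≤-trans (ℕₚ.≤-reflexive (total-∷ is b B))
                                       (ℕₚ.+-mono-≤ (total-single is aps) (total≤ aps B))

  light heavy : ℕ → List I → List Cell → List I
  light t is B = filter (λ i → hits (region i) B ≤? t) is
  heavy t is B = filter (λ i → ¬? (hits (region i) B ≤? t)) is

  light-sound : ∀ t is B → All (λ i → i ∈ is × hits (region i) B ≤ t) (light t is B)
  light-sound t is B = All.tabulate (∈-filter⁻ (λ i → hits (region i) B ≤? t))

  private
    module _ (t : ℕ) (B : List Cell) where
      light? = λ i → hits (region i) B ≤? t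

      accept : ∀ {i is} → hits (region i) B ≤ t →
               light t (i ∷ is) B ≡ i ∷ light t is B × heavy t (i ∷ is) B ≡ heavy t is B
      accept ok = filter-accept light? ok , filter-reject (¬? ∘ light?) (λ bad → bad ok)

      reject : ∀ {i is} → ¬ hits (region i) B ≤ t →
               light t (i ∷ is) B ≡ light t is B × heavy t (i ∷ is) B ≡ i ∷ heavy t is B
      reject bad = filter-reject light? bad , filter-accept (¬? ∘ light?) bad

    light+heavy : ∀ t is B → length (light t is B) + length (heavy t is B) ≡ length is
    light+heavy t []       B = refl
    light+heavy t (i ∷ is) B with hits (region i) B ≤? t
    ... | yes ok  = let (l≡ , h≡) = accept t B {i} {is} ok in
      trans (cong₂ (λ l h → length l + length h) l≡ h≡) (cong suc (light+heavy t is B))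
    ... | no  bad = let (l≡ , h≡) = reject t B {i} {is} bad in
      trans (cong₂ (λ l h → length l + length h) l≡ h≡)
            (trans (ℕₚ.+-suc _ _) (cong suc (light+heavy t is B)))

    heavy-total : ∀ t is B → suc t * length (heavy t is B) ≤ total is B
    heavy-total t []       B = ℕₚ.≤-reflexive (ℕₚ.*-zeroʳ t)
    heavy-total t (i ∷ is) B with hits (region i) B ≤? t
    ... | yes ok  = subst (λ h → suc t * length h ≤ total (i ∷ is) B)
                          (sym (proj₂ (accept t B {i} {is} ok)))
                          (ℕₚ.≤-trans (heavy-total t is B) (ℕₚ.m≤n+m _ _))
    ... | no  bad = subst (λ h → suc t * length h ≤ total (i ∷ is) B)
                          (sym (proj₂ (reject t B {i} {is} bad)))
                          (ℕₚ.≤-trans (ℕₚ.≤-reflexive (ℕₚ.*-suc (suc t) _))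
                                      (ℕₚ.+-mono-≤ (ℕₚ.≰⇒> bad) (heavy-total t is B)))

  -- Pigeonhole: every heavy region takes more than t of breaker's cells, so
  -- (t+1)·|is| ≤ |B| + (t+1)·(number of light regions).
  pigeonhole : ∀ {is} → AllPairs Apart is → ∀ t B →
               suc t * length is ≤ length B + suc t * length (light t is B)
  pigeonhole {is} aps t B = begin
    suc t * length is                            ≡⟨ cong (suc t *_) (sym (light+heavy t is B)) ⟩
    suc t * (l + length (heavy t is B))          ≡⟨ ℕₚ.*-distribˡ-+ (suc t) l _ ⟩
    suc t * l + suc t * length (heavy t is B)    ≤⟨ ℕₚ.+-monoʳ-≤ (suc t * l) (heavy-total t is B) ⟩
    suc t * l + total is B                       ≤⟨ ℕₚ.+-monoʳ-≤ (suc t * l) (total≤ aps B) ⟩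
    suc t * l + length B                         ≡⟨ ℕₚ.+-comm (suc t * l) _ ⟩
    length B + suc t * l                         ∎
    where
    open ℕₚ.≤-Reasoning
    l = length (light t is B)

  someLight : ∀ {is B} t → AllPairs Apart is → length B < suc t * length is →
              ∃ λ i → i ∈ is × hits (region i) B ≤ t
  someLight {is} {B} t aps small with light t is B | light-sound t is B | pigeonhole aps t B
  ... | []    | _     | ph = ⊥-elim (ℕₚ.<⇒≱ small (ℕₚ.≤-trans ph (ℕₚ.≤-reflexive
         (trans (cong (_+_ (length B)) (ℕₚ.*-zeroʳ (suc t))) (ℕₚ.+-identityʳ _)))))
  ... | i ∷ _ | s ∷ _ | _  = i , s

  twoLight : ∀ {R : I → I → Set} {is B} t → AllPairs R is → AllPairs Apart is →
             length B + suc t < suc t * length is →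
             ∃₂ λ i j → R i j × (i ∈ is × hits (region i) B ≤ t) × (j ∈ is × hits (region j) B ≤ t)
  twoLight {is = is} {B} t rel aps small
    with light t is B | light-sound t is B | pigeonhole aps t B
       | AllPairsₚ.filter⁺ (λ i → hits (region i) B ≤? t) rel
  ... | []        | _           | ph | _ = ⊥-elim (ℕₚ.<⇒≱ small (ℕₚ.≤-trans ph
         (ℕₚ.+-monoʳ-≤ (length B) (ℕₚ.≤-trans (ℕₚ.≤-reflexive (ℕₚ.*-zeroʳ (suc t))) z≤n))))
  ... | _ ∷ []    | _           | ph | _ = ⊥-elim (ℕₚ.<⇒≱ small (ℕₚ.≤-trans ph (ℕₚ.≤-reflexive
         (cong (_+_ (length B)) (ℕₚ.*-identityʳ (suc t))))))
  ... | i ∷ j ∷ _ | si ∷ sj ∷ _ | _  | (Rij ∷ _) ∷ _ = i , j , Rij , si , sj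

-- The four squares containing a cell, as offsets from it (listed in the order of squareAt).
data Quadrant : Set where
  NE NW SW SE : Quadrant

quadrantOffsets : Quadrant → List Offset
quadrantOffsets NE = (stay , stay) ∷ (fwd , stay) ∷ (stay , fwd) ∷ (fwd , fwd) ∷ []
quadrantOffsets NW = (back , stay) ∷ (stay , stay) ∷ (back , fwd) ∷ (stay , fwd) ∷ []
quadrantOffsets SW = (back , back) ∷ (stay , back) ∷ (back , stay) ∷ (stay , stay) ∷ []
quadrantOffsets SE = (stay , back) ∷ (fwd , back) ∷ (stay , stay) ∷ (fwd , stay) ∷ []

quadrant-square : ∀ {M} c q → All (λ o → c ⊕ o ∈ M) (quadrantOffsets q) → Contains P44 M
quadrant-square c NE cells = square⇒contains c (Allₚ.map⁺ cells)
quadrant-square (x , y) NW (a ∷ b ∷ c ∷ d ∷ []) = square⇒contains (predℤ x , y)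
  (a ∷ at (sym (ℤₚ.suc-pred x) ,≡ refl) b ∷ c ∷ at (sym (ℤₚ.suc-pred x) ,≡ refl) d ∷ [])
quadrant-square (x , y) SW (a ∷ b ∷ c ∷ d ∷ []) = square⇒contains (predℤ x , predℤ y)
  (a ∷ at (sym (ℤₚ.suc-pred x) ,≡ refl) b ∷ at (refl ,≡ sym (ℤₚ.suc-pred y)) c
     ∷ at (sym (ℤₚ.suc-pred x) ,≡ sym (ℤₚ.suc-pred y)) d ∷ [])
quadrant-square (x , y) SE (a ∷ b ∷ c ∷ d ∷ []) = square⇒contains (x , predℤ y)
  (a ∷ b ∷ at (refl ,≡ sym (ℤₚ.suc-pred y)) c ∷ at (refl ,≡ sym (ℤₚ.suc-pred y)) d ∷ [])

completeQuadrant : ∀ {a b M B} c q (own rest : List Offset) →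
  All (_∈ own ++ rest) (quadrantOffsets q) → All (λ o → c ⊕ o ∈ M) own →
  length rest ≡ a → Unique rest → All (λ o → c ⊕ o ∉ M × c ⊕ o ∉ B) rest →
  MakerWins P44 a b M B
completeQuadrant {M = M} c q own rest cover owned len uniq free =
  move (map (c ⊕_) rest) (trans (length-map (c ⊕_) rest) len)
       (Uniqueₚ.map⁺ (⊕-injective c) uniq , Allₚ.map⁺ free)
       (inj₁ (quadrant-square c q (All.map place cover)))
  where
  place : ∀ {o} → o ∈ own ++ rest → c ⊕ o ∈ map (c ⊕_) rest ++ M
  place o∈ = [ ∈-++⁺ʳ _ ∘ All.lookup owned , ∈-++⁺ˡ ∘ ∈-map⁺ (c ⊕_) ]′ (∈-++⁻ own o∈)

one-spot : ∀ {c B} → hits (nbhd c) B ≤ 1 → ∃ λ o₀ → ∀ o → c ⊕ o ∈ B → o ≡ o₀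
one-spot {c} {B} le with filter (_∈? nbhd c) B | le
                        | (λ o c⊕o∈B → ∈-filter⁺ (_∈? nbhd c) {xs = B} c⊕o∈B (⊕∈nbhd c o))
                        | All.tabulate (proj₂ ∘ ∈-filter⁻ (_∈? nbhd c) {xs = B})
... | []         | _       | caught | _          =
  (stay , stay) , λ o c⊕o∈B → case caught o c⊕o∈B of λ ()
... | _ ∷ _ ∷ _  | s≤s () | _      | _
... | x ∷ []     | _       | caught | x∈nb ∷ [] with ∈-map⁻ (c ⊕_) {xs = allOffsets} x∈nb
...   | o₀ , _ , refl = o₀ , λ o c⊕o∈B → case caught o c⊕o∈B of λ { (here e) → ⊕-injective c e }

seed-owned : ∀ {ns M n} → Seeded ns M → n ∈ ns → seed n ∈ M
seed-owned (refl , _) n∈ = ∈-map⁺ seed n∈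

-- A seed with at most one breaker cell nearby is completed with three cells: to its
-- north-east square or, if that breaker cell is there, to its south-west square.
completeSeed : ∀ {b ns M B n} → Seeded ns M → n ∈ ns → hits (nbhd (seed n)) B ≤ 1 →
               MakerWins P44 3 b M B
completeSeed {b} {ns} {M} {B} {n} sd n∈ light = choose (one-spot light)
  where
  centre : Offset
  centre = (stay , stay)
  restNE restSW : List Offset
  restNE = (fwd , stay) ∷ (stay , fwd) ∷ (fwd , fwd) ∷ []
  restSW = (back , back) ∷ (stay , back) ∷ (back , stay) ∷ []

  NE-SW-apart : All (_∉ restSW) restNE
  NE-SW-apart = from-yes (All.all? (λ o → ¬? (o ∈ᵒ? restSW)) restNE)

  complete : ∀ {o₀} → (∀ o → seed n ⊕ o ∈ B → o ≡ o₀) → ∀ q rest →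
             All (_∈ centre ∷ rest) (quadrantOffsets q) → Unique rest → length rest ≡ 3 →
             centre ∉ rest → o₀ ∉ rest → MakerWins P44 3 b M B
  complete spot q rest cover uniq len centre∉ o₀∉ =
    completeQuadrant (seed n) q (centre ∷ []) rest cover (seed-owned sd n∈ ∷ []) len uniq
      (All.tabulate λ o∈ → (λ s⊕o∈M → centre∉ (subst (_∈ rest) (seed-alone sd n∈ _ s⊕o∈M) o∈))
                         , (λ s⊕o∈B → o₀∉ (subst (_∈ rest) (spot _ s⊕o∈B) o∈)))

  choose : (∃ λ o₀ → ∀ o → seed n ⊕ o ∈ B → o ≡ o₀) → MakerWins P44 3 b M B
  choose (o₀ , spot) with o₀ ∈ᵒ? restNE
  ... | no  o₀∉NE = complete spot NE restNE
                      (from-yes (All.all? (_∈ᵒ? centre ∷ restNE) (quadrantOffsets NE)))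
                      (from-yes (unique? restNE)) refl (from-no (centre ∈ᵒ? restNE)) o₀∉NE
  ... | yes o₀∈NE = complete spot SW restSW
                      (from-yes (All.all? (_∈ᵒ? centre ∷ restSW) (quadrantOffsets SW)))
                      (from-yes (unique? restSW)) refl (from-no (centre ∈ᵒ? restSW))
                      (All.lookup NE-SW-apart o₀∈NE)

module SeedRegions = Pigeonhole (nbhd ∘ seed)

seeds-apart : ∀ {ns} → AllPairs Sep ns → AllPairs SeedRegions.Apart ns
seeds-apart = AllPairs.map sep-apart

-- (3,5): maker plants three separated seeds; five breaker cells leave one of the three
-- neighbourhoods with at most one breaker cell, and that seed is completed.
winner35 : Winner P44 3 5
winner35 = seeding 1 {[]} {[]} {[]} (refl , []) λ {ns} {M} {B} sd lns lB →
  let (n , n∈ , light) = SeedRegions.someLight {B = B} 1 (seeds-apart (proj₂ sd))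
                           (subst₂ (λ x y → x < 2 * y) (sym lB) (sym lns) ℕₚ.≤-refl)
  in completeSeed sd n∈ light

-- Threats.  Maker extends a seed s to a domino {s, s ⊕ extension d}; each of the two
-- squares containing the domino (its sides) then lacks exactly two cells, the threat.
data Direction : Set where
  east west north south : Direction

data Side : Set where
  left right : Side

extension : Direction → Offset
extension east  = (fwd , stay)
extension west  = (back , stay)
extension north = (stay , fwd)
extension south = (stay , back)

extension-moves : ∀ d → extension d ≢ (stay , stay)
extension-moves east  ()
extension-moves west  ()
extension-moves north ()
extension-moves south ()

sideQuadrant : Direction → Side → Quadrant
sideQuadrant east  left  = NE
sideQuadrant east  right = SE
sideQuadrant west  left  = NW
sideQuadrant west  right = SW
sideQuadrant north left  = NW
sideQuadrant north right = NE
sideQuadrant south left  = SW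
sideQuadrant south right = SE

threatPair : Direction → Side → Offset × Offset
threatPair east  left  = (stay , fwd)  , (fwd , fwd)
threatPair east  right = (stay , back) , (fwd , back)
threatPair west  left  = (back , fwd)  , (stay , fwd)
threatPair west  right = (back , back) , (stay , back)
threatPair north left  = (back , stay) , (back , fwd)
threatPair north right = (fwd , stay)  , (fwd , fwd)
threatPair south left  = (back , back) , (back , stay)
threatPair south right = (fwd , back)  , (fwd , stay)

threat : Direction → Side → List Offset
threat d σ = proj₁ (threatPair d σ) ∷ proj₂ (threatPair d σ) ∷ []

own : Direction → List Offset
own d = (stay , stay) ∷ extension d ∷ []

footprint : Direction → List Offset
footprint d = extension d ∷ threat d left ++ threat d right

threat⊆footprint : ∀ d σ → ∀ {o} → o ∈ threat d σ → o ∈ footprint d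
threat⊆footprint d left  = there ∘ ∈-++⁺ˡ
threat⊆footprint d right = there ∘ ∈-++⁺ʳ (threat d left)

ThreatShape : Direction → Side → Set
ThreatShape d σ = All (_∈ own d ++ threat d σ) (quadrantOffsets (sideQuadrant d σ))
                × Unique (threat d σ) × All (_∉ own d) (threat d σ)

threatShape? : ∀ d σ → Dec (ThreatShape d σ)
threatShape? d σ = All.all? (_∈ᵒ? own d ++ threat d σ) (quadrantOffsets (sideQuadrant d σ))
             ×-dec unique? (threat d σ) ×-dec All.all? (λ o → ¬? (o ∈ᵒ? own d)) (threat d σ)

threat-shape : ∀ d σ → ThreatShape d σ
threat-shape east  left  = from-yes (threatShape? east left)
threat-shape east  right = from-yes (threatShape? east right)
threat-shape west  left  = from-yes (threatShape? west left)
threat-shape west  right = from-yes (threatShape? west right)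
threat-shape north left  = from-yes (threatShape? north left)
threat-shape north right = from-yes (threatShape? north right)
threat-shape south left  = from-yes (threatShape? south left)
threat-shape south right = from-yes (threatShape? south right)

sides-apart : ∀ d → All (_∉ threat d right) (threat d left)
sides-apart east  = from-yes (All.all? (λ o → ¬? (o ∈ᵒ? threat east right)) (threat east left))
sides-apart west  = from-yes (All.all? (λ o → ¬? (o ∈ᵒ? threat west right)) (threat west left))
sides-apart north = from-yes (All.all? (λ o → ¬? (o ∈ᵒ? threat north right)) (threat north left))
sides-apart south = from-yes (All.all? (λ o → ¬? (o ∈ᵒ? threat south right)) (threat south left))

-- Whatever single offset breaker occupies near a seed, some direction keeps both
-- threats and the extension away from it (a check over the nine offsets).
freeDirection : ∀ o → ∃ λ d → o ∉ footprint d
freeDirection o = Any.satisfied (All.lookup table (offset∈all o))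
  where
  directions : List Direction
  directions = east ∷ west ∷ north ∷ south ∷ []
  table : All (λ o → Any (λ d → o ∉ footprint d) directions) allOffsets
  table = from-yes (All.all? (λ o → Any.any? (λ d → ¬? (o ∈ᵒ? footprint d)) directions) allOffsets)

threatRegion : Cell × Direction × Side → List Cell
threatRegion (s , d , σ) = map (s ⊕_) (threat d σ)

module ThreatRegions = Pigeonhole threatRegion

threatRegion⊆nbhd : ∀ {s d σ c} → c ∈ threatRegion (s , d , σ) → c ∈ nbhd s
threatRegion⊆nbhd {s} {d} {σ} c∈ with ∈-map⁻ (s ⊕_) {xs = threat d σ} c∈
... | o , _ , refl = ⊕∈nbhd s o

sides-apart-regions : ∀ s d → ThreatRegions.Apart (s , d , left) (s , d , right)
sides-apart-regions s d (c∈L , c∈R) with ∈-map⁻ (s ⊕_) {xs = threat d left} c∈L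
                                      | ∈-map⁻ (s ⊕_) {xs = threat d right} c∈R
... | o , o∈L , refl | o' , o'∈R , e = All.lookup (sides-apart d) o∈L
                                         (subst (_∈ threat d right) (sym (⊕-injective s e)) o'∈R)

fourThreats : Cell → Direction → Cell → Direction → List (Cell × Direction × Side)
fourThreats s₁ d₁ s₂ d₂ =
  (s₁ , d₁ , left) ∷ (s₁ , d₁ , right) ∷ (s₂ , d₂ , left) ∷ (s₂ , d₂ , right) ∷ []

fourThreats-apart : ∀ {s₁ s₂} d₁ d₂ → Disjoint (nbhd s₁) (nbhd s₂) →
                    AllPairs ThreatRegions.Apart (fourThreats s₁ d₁ s₂ d₂)
fourThreats-apart {s₁} {s₂} d₁ d₂ apart =
  (sides-apart-regions s₁ d₁ ∷ cross ∷ cross ∷ []) ∷ (cross ∷ cross ∷ [])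
  ∷ (sides-apart-regions s₂ d₂ ∷ []) ∷ [] ∷ []
  where
  cross : ∀ {σ σ'} → ThreatRegions.Apart (s₁ , d₁ , σ) (s₂ , d₂ , σ')
  cross {σ} {σ'} (c∈ , c∈') =
    apart (threatRegion⊆nbhd {s₁} {d₁} {σ} c∈ , threatRegion⊆nbhd {s₂} {d₂} {σ'} c∈')

completeThreat : ∀ {b M B o₀} s d σ k → (∀ o → s ⊕ o ∈ M → o ∈ own d) →
                 All (λ o → s ⊕ o ∈ M) (own d) → (∀ o → s ⊕ o ∈ B → o ≡ o₀) →
                 o₀ ∉ footprint d → hits (threatRegion (s , d , σ)) k ≤ 0 →
                 MakerWins P44 2 b M (k ++ B)
completeThreat {B = B} s d σ k alone owned spot free unhit =
  let (completes , distinct , outside) = threat-shape d σ in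
  completeQuadrant s (sideQuadrant d σ) (own d) (threat d σ) completes owned refl distinct
    (All.zipWith (λ (o∉own , s⊕o∉kB) → (λ s⊕o∈M → o∉own (alone _ s⊕o∈M)) , s⊕o∉kB)
                 (outside , All.tabulate unmarked-by-breaker))
  where
  unmarked-by-breaker : ∀ {o} → o ∈ threat d σ → s ⊕ o ∉ k ++ B
  unmarked-by-breaker o∈ s⊕o∈ =
    [ no-hits unhit (∈-map⁺ (s ⊕_) o∈)
    , (λ s⊕o∈B → free (subst (_∈ footprint d) (spot _ s⊕o∈B) (threat⊆footprint d σ o∈))) ]′
    (∈-++⁻ k s⊕o∈)

alone-after : ∀ {ns M n} d extra → Seeded ns M → n ∈ ns →
  All (λ e → e ≡ seed n ⊕ extension d ⊎ e ∉ nbhd (seed n)) extra →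
  ∀ o → seed n ⊕ o ∈ extra ++ M → o ∈ own d
alone-after {n = n} d extra sd n∈ extra-ok o p with ∈-++⁻ extra p
... | inj₂ p∈M = here (seed-alone sd n∈ o p∈M)
... | inj₁ p∈extra with All.lookup extra-ok p∈extra
...   | inj₁ e   = there (here (⊕-injective (seed n) e))
...   | inj₂ far = ⊥-elim (far (⊕∈nbhd (seed n) o))

-- The extension of a seed is unmarked: maker owns only the seed near it, and it lies in
-- the footprint, which avoids breaker's cell near the seed.
extension-fresh : ∀ {ns M B u o₀} d → Seeded ns M → u ∈ ns → (∀ o → seed u ⊕ o ∈ B → o ≡ o₀) →
                  o₀ ∉ footprint d → seed u ⊕ extension d ∉ M × seed u ⊕ extension d ∉ B
extension-fresh d sd u∈ spot free =
  extension-moves d ∘ seed-alone sd u∈ _ ,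
  λ e∈B → free (subst (_∈ footprint d) (spot _ e∈B) (here refl))

-- Two separated seeds each have at most one breaker cell nearby.
-- Maker extends both along directions avoiding those cells, creating four disjoint
-- threats; breaker's three cells leave one unhit, and maker completes it.
twoThreats : ∀ {ns M B u₁ u₂} → Seeded ns M → u₁ ∈ ns → u₂ ∈ ns → Sep u₁ u₂ →
             hits (nbhd (seed u₁)) B ≤ 1 → hits (nbhd (seed u₂)) B ≤ 1 → MakerWins P44 2 3 M B
twoThreats {ns} {M} {B} {u₁} {u₂} sd u₁∈ u₂∈ sep light₁ light₂
  with one-spot light₁ | one-spot light₂
... | o₁ , spot₁ | o₂ , spot₂ with freeDirection o₁ | freeDirection o₂
... | d₁ , free₁ | d₂ , free₂ =
  move (e₁ ∷ e₂ ∷ []) refl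
       ((e₁≢e₂ ∷ []) ∷ [] ∷ [] ,
        extension-fresh d₁ sd u₁∈ spot₁ free₁ ∷ extension-fresh d₂ sd u₂∈ spot₂ free₂ ∷ [])
       (inj₂ λ k lk _ → endgame k lk)
  where
  s₁ = seed u₁
  s₂ = seed u₂
  e₁ = s₁ ⊕ extension d₁
  e₂ = s₂ ⊕ extension d₂
  apart : Disjoint (nbhd s₁) (nbhd s₂)
  apart = sep-apart sep
  e₁∈ : e₁ ∈ nbhd s₁
  e₁∈ = ⊕∈nbhd s₁ (extension d₁)
  e₂∈ : e₂ ∈ nbhd s₂
  e₂∈ = ⊕∈nbhd s₂ (extension d₂)
  e₁≢e₂ : e₁ ≢ e₂
  e₁≢e₂ e = apart (e₁∈ , subst (_∈ nbhd s₂) (sym e) e₂∈)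

  alone₁ = alone-after d₁ (e₁ ∷ e₂ ∷ []) sd u₁∈
             (inj₁ refl ∷ inj₂ (λ e₂∈₁ → apart (e₂∈₁ , e₂∈)) ∷ [])
  alone₂ = alone-after d₂ (e₁ ∷ e₂ ∷ []) sd u₂∈
             (inj₂ (λ e₁∈₂ → apart (e₁∈ , e₁∈₂)) ∷ inj₁ refl ∷ [])

  strike₁ : ∀ σ k → hits (threatRegion (s₁ , d₁ , σ)) k ≤ 0 → MakerWins P44 2 3 (e₁ ∷ e₂ ∷ M) (k ++ B)
  strike₁ σ k = completeThreat s₁ d₁ σ k alone₁
                  (there (there (seed-owned sd u₁∈)) ∷ here refl ∷ []) spot₁ free₁
  strike₂ : ∀ σ k → hits (threatRegion (s₂ , d₂ , σ)) k ≤ 0 → MakerWins P44 2 3 (e₁ ∷ e₂ ∷ M) (k ++ B)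
  strike₂ σ k = completeThreat s₂ d₂ σ k alone₂
                  (there (there (seed-owned sd u₂∈)) ∷ there (here refl) ∷ []) spot₂ free₂

  endgame : ∀ k → length k ≡ 3 → MakerWins P44 2 3 (e₁ ∷ e₂ ∷ M) (k ++ B)
  endgame k lk with ThreatRegions.someLight {B = k} 0 (fourThreats-apart d₁ d₂ apart)
                                            (subst (_< 4) (sym lk) ℕₚ.≤-refl)
  ... | _ , here refl , unhit                         = strike₁ left  k unhit
  ... | _ , there (here refl) , unhit                 = strike₁ right k unhit
  ... | _ , there (there (here refl)) , unhit         = strike₂ left  k unhit
  ... | _ , there (there (there (here refl))) , unhit = strike₂ right k unhit

-- (2,3): three turns of seeding give six separated seeds against nine breaker cells, so
-- two seeds have at most one breaker cell nearby, and the endgame applies.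
winner23 : Winner P44 2 3
winner23 = seeding 3 {[]} {[]} {[]} (refl , []) λ {ns} {M} {B} sd lns lB →
  let (u₁ , u₂ , sep , (u₁∈ , light₁) , (u₂∈ , light₂)) =
        SeedRegions.twoLight {B = B} 1 (proj₂ sd) (seeds-apart (proj₂ sd))
          (subst₂ (λ x y → x + 2 < 2 * y) (sym lB) (sym lns) ℕₚ.≤-refl)
  in twoThreats sd u₁∈ u₂∈ sep light₁ light₂

proposition7p7 : Winner P44 1 0 × Loser P44 1 1 ×
    Winner P44 2 3 × Loser P44 2 4 ×
    Winner P44 3 5 × Loser P44 3 6 ×
    ((n b : ℕ) → n ≥ 4 → Winner P44 n b)
proposition7p7 = winner10 , loser11 , winner23 , loser24 , winner35 , loser36 , winner≥4
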